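{- Let $G$ be a finite abelian group of odd order $v$ and let $J$ be a subgroup of $G$ of order $t$. Let $\lambda,n,k$ be positive integers with $n\ge k$, $v=\frac{2nk}{\lambda}+t$ and $t\mid v$. Then there exists a ${}^\lambda\mathrm{NH}_t(n;k)$ over $G$ relative to $J$.
   Context: Groups are written additively. An $m\times n$ partially filled (p.f.) array over $G$ is an $m\times n$ matrix each of whose cells is empty or contains an element of $G$. For a subgroup $J$ of order $t$, a ${}^\lambda\mathrm{NH}_t(m,n;h,k)$ over $G$ relative to $J$ is an $m\times n$ p.f. array $A$ over $G$ such that: (a) each row contains exactly $h$ filled cells and each column exactly $k$ filled cells; (b) the multiset obtained by taking, for every filled cell with entry $x$, both $x$ and $-x$ (with multiplicity), is exactly the multiset containing each element of $G\setminus J$ exactly $\lambda$ times; (c) each row sum (left to right) and each column sum (top to bottom) is nonzero. ${}^\lambda\mathrm{NH}_t(n;k)$ denotes ${}^\lambda\mathrm{NH}_t(n,n;k,k)$. -}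

module Defs where

open import Level using (Level; _⊔_)
open import Algebra.Bundles using (AbelianGroup)
open import Data.Nat using (ℕ; zero; suc; _+_)
open import Data.Fin using (Fin; zero; suc)
open import Data.Fin.Properties using () renaming (_≟_ to _≟F_)
open import Data.Maybe using (Maybe; just; nothing)
open import Data.Product using (Σ; ∃; _×_; _,_; proj₁; proj₂)
open import Data.Unit.Polymorphic using (⊤)
open import Relation.Nullary using (¬_; Dec; yes; no)
open import Relation.Binary.PropositionalEquality using (_≡_; refl)
open import Relation.Unary using (Pred)

sumℕ : {n : ℕ} → (Fin n → ℕ) → ℕ
sumℕ {zero}  f = 0
sumℕ {suc n} f = f zero + sumℕ (λ i → f (suc i))

module _ {c ℓ : Level} (G : AbelianGroup c ℓ) where
  open AbelianGroup G

  sumG : {n : ℕ} → (Fin n → Carrier) → Carrier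
  sumG {zero}  f = ε
  sumG {suc n} f = f zero ∙ sumG (λ i → f (suc i))

  HasOrder : {p : Level} → Pred Carrier p → ℕ → Set (c ⊔ ℓ ⊔ p)
  HasOrder P t =
    Σ (Fin t → Carrier) λ f →
      (∀ i → P (f i)) ×
      (∀ i j → f i ≈ f j → i ≡ j) ×
      (∀ g → P g → ∃ λ i → f i ≈ g)

  GroupOrder : ℕ → Set (c ⊔ ℓ)
  GroupOrder v = HasOrder {p = Level.zero} (λ _ → ⊤) v

  record IsSubgroup {p : Level} (J : Pred Carrier p) : Set (c ⊔ ℓ ⊔ p) where
    field
      resp   : ∀ {x y} → x ≈ y → J x → J y
      has-ε  : J ε
      closed-∙ : ∀ {x y} → J x → J y → J (x ∙ y)
      closed-⁻¹ : ∀ {x} → J x → J (x ⁻¹)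

  decEq : {v : ℕ} → GroupOrder v → (x y : Carrier) → Dec (x ≈ y)
  decEq (f , _ , inj , surj) x y with surj x _ | surj y _
  ... | i , fi≈x | j , fj≈y with i ≟F j
  ...   | yes refl = yes (trans (sym fi≈x) fj≈y)
  ...   | no i≢j  = no (λ x≈y → i≢j (inj i j (trans fi≈x (trans x≈y (sym fj≈y)))))

  PFArray : ℕ → ℕ → Set c
  PFArray m n = Fin m → Fin n → Maybe Carrier

  filled : Maybe Carrier → ℕ
  filled (just _) = 1
  filled nothing  = 0

  entry0 : Maybe Carrier → Carrier
  entry0 (just x) = x
  entry0 nothing  = ε

  module _ {v : ℕ} (ord : GroupOrder v) where
    [_≈?_] : Carrier → Carrier → ℕ
    [ x ≈? y ] with decEq ord x y
    ... | yes _ = 1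
    ... | no _  = 0

    -- multiplicity of g in the multiset {x, -x : x a filled entry}
    cellMult : Carrier → Maybe Carrier → ℕ
    cellMult g (just x) = [ x ≈? g ] + [ x ⁻¹ ≈? g ]
    cellMult g nothing  = 0

    mult : {m n : ℕ} → PFArray m n → Carrier → ℕ
    mult A g = sumℕ (λ i → sumℕ (λ j → cellMult g (A i j)))

    IsNH : {p : Level} (J : Pred Carrier p) (λ' m n h k : ℕ) → PFArray m n → Set (c ⊔ ℓ ⊔ p)
    IsNH J λ' m n h k A =
      (∀ i → sumℕ (λ j → filled (A i j)) ≡ h) ×
      (∀ j → sumℕ (λ i → filled (A i j)) ≡ k) ×
      (∀ g → (J g → mult A g ≡ 0) × (¬ J g → mult A g ≡ λ')) ×
      (∀ i → ¬ (sumG (λ j → entry0 (A i j)) ≈ ε)) ×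
      (∀ j → ¬ (sumG (λ i → entry0 (A i j)) ≈ ε))

-- Since v is odd, no nonzero element is its own inverse, so G ∖ J splits into M = (v - t) / 2 pairs {x, x⁻¹};
-- fix representatives R 0, …, R (M - 1). Fill cell (i, j) iff d = (i + j) mod n < k, with ±R ((i k + d) mod M).
-- Every row and column then has k filled cells, and as n k = λ M each pair {x, x⁻¹} is used exactly λ times.
-- For k ≤ 2 the row and column sums are R r or R r ∙ R s, never ε; for k ≥ 3 the signs of the first two
-- entries of each row are chosen one after another so that all row and column sums avoid ε.
module Submission where

open import Defs
open import Level using (Level; _⊔_)
open import Algebra.Bundles using (AbelianGroup; CommutativeMonoid)
open import Data.Bool using (Bool; true; false; not; _∧_; if_then_else_)
open import Data.Empty using (⊥; ⊥-elim)
open import Data.Fin using (Fin; zero; suc; toℕ; fromℕ<)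
import Data.Fin.Properties as Fin
open import Data.Maybe using (Maybe; just; nothing)
open import Data.Nat using (ℕ; zero; suc; _+_; _*_; _∸_; _%_; _≤_; _<_; _<?_; z≤n; s≤s; NonZero)
open import Data.Nat.Properties
open import Data.Nat.DivMod
open import Data.Nat.Divisibility using (_∣_)
open import Data.Nat.Tactic.RingSolver using (solve-∀)
open import Data.Product using (Σ; ∃; _,_; proj₁; proj₂)
open import Data.Sum using (_⊎_; inj₁; inj₂)
open import Function using (_∘_)
open import Relation.Nullary using (¬_; Dec; yes; no)
open import Relation.Nullary.Decidable using (isYes)
open import Relation.Binary.PropositionalEquality as ≡ using (_≡_; _≢_)
open import Relation.Unary using (Pred)

[m%n+o]%n≡[m+o]%n : ∀ m o n .{{_ : NonZero n}} → (m % n + o) % n ≡ (m + o) % n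
[m%n+o]%n≡[m+o]%n m o n = ≡.trans (%-distribˡ-+ (m % n) o n)
  (≡.trans (≡.cong (λ x → (x + o % n) % n) (m%n%n≡m%n m n)) (≡.sym (%-distribˡ-+ m o n)))

module IndexedSum {c ℓ : Level} (M : CommutativeMonoid c ℓ) where
  open CommutativeMonoid M
  open import Relation.Binary.Reasoning.Setoid setoid

  ∑ : ℕ → (ℕ → Carrier) → Carrier
  ∑ zero    F = ε
  ∑ (suc n) F = F 0 ∙ ∑ n (λ j → F (suc j))

  ∑-cong : ∀ n {F G : ℕ → Carrier} → (∀ j → j < n → F j ≈ G j) → ∑ n F ≈ ∑ n G
  ∑-cong zero    F≈G = refl
  ∑-cong (suc n) F≈G = ∙-cong (F≈G 0 (s≤s z≤n)) (∑-cong n (λ j j<n → F≈G (suc j) (s≤s j<n)))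

  ∑-+ : ∀ a b F → ∑ (a + b) F ≈ ∑ a F ∙ ∑ b (λ j → F (a + j))
  ∑-+ zero    b F = sym (identityˡ _)
  ∑-+ (suc a) b F = trans (∙-cong refl (∑-+ a b (λ j → F (suc j)))) (sym (assoc _ _ _))

  ∑-ε : ∀ n F → (∀ j → j < n → F j ≈ ε) → ∑ n F ≈ ε
  ∑-ε zero    F F≈ε = refl
  ∑-ε (suc n) F F≈ε =
    trans (∙-cong (F≈ε 0 (s≤s z≤n)) (∑-ε n _ (λ j j<n → F≈ε (suc j) (s≤s j<n)))) (identityˡ ε)

  ∑-support : ∀ {k n} F → k ≤ n → (∀ j → k ≤ j → F j ≈ ε) → ∑ n F ≈ ∑ k F
  ∑-support {k} F k≤n F≈ε with o , ≡.refl ← m≤n⇒∃[o]m+o≡n k≤n = begin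
    ∑ (k + o) F                     ≈⟨ ∑-+ k o F ⟩
    ∑ k F ∙ ∑ o (λ j → F (k + j))   ≈⟨ ∙-cong refl (∑-ε o _ (λ j _ → F≈ε (k + j) (m≤m+n k j))) ⟩
    ∑ k F ∙ ε                       ≈⟨ identityʳ _ ⟩
    ∑ k F                           ∎

  ∑-rotate : ∀ n c F .{{_ : NonZero n}} → ∑ n (λ j → F ((c + j) % n)) ≈ ∑ n F
  ∑-rotate n c F = trans (∑-cong n (λ j _ → reflexive (≡.cong F (≡.sym ([m%n+o]%n≡[m+o]%n c j n)))))
                         (rotate-by-residue (c % n) (m%n<n c n))
    where
    rotate-by-residue : ∀ r → r < n → ∑ n (λ j → F ((r + j) % n)) ≈ ∑ n F
    rotate-by-residue r r<n with o , ≡.refl ← m≤n⇒∃[o]m+o≡n (<⇒≤ r<n) = begin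
      ∑ (r + o) G                            ≡⟨ ≡.cong (λ m → ∑ m G) (+-comm r o) ⟩
      ∑ (o + r) G                            ≈⟨ ∑-+ o r G ⟩
      ∑ o G ∙ ∑ r (λ j → G (o + j))          ≈⟨ ∙-cong (∑-cong o (λ j j<o → reflexive (≡.cong F (m<n⇒m%n≡m (+-monoʳ-< r j<o)))))
                                                       (∑-cong r (λ j j<r → reflexive (≡.cong F (wraps j j<r)))) ⟩
      ∑ o (λ j → F (r + j)) ∙ ∑ r F          ≈⟨ comm _ _ ⟩
      ∑ r F ∙ ∑ o (λ j → F (r + j))          ≈⟨ sym (∑-+ r o F) ⟩
      ∑ (r + o) F                            ∎
      where
      G : ℕ → Carrier
      G j = F ((r + j) % (r + o))
      wraps : ∀ j → j < r → (r + (o + j)) % (r + o) ≡ j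
      wraps j j<r = ≡.trans (≡.cong (_% (r + o)) (≡.trans (≡.sym (+-assoc r o j)) (+-comm (r + o) j)))
                      (≡.trans ([m+n]%n≡m%n j (r + o)) (m<n⇒m%n≡m (≤-trans j<r (m≤m+n r o))))

  ∑-blocks : ∀ n k F → ∑ n (λ i → ∑ k (λ d → F (i * k + d))) ≈ ∑ (n * k) F
  ∑-blocks zero    k F = refl
  ∑-blocks (suc n) k F = begin
    ∑ k F ∙ ∑ n (λ i → ∑ k (λ d → F (k + i * k + d)))
      ≈⟨ ∙-cong refl (∑-cong n (λ i _ → ∑-cong k (λ d _ → reflexive (≡.cong F (+-assoc k (i * k) d))))) ⟩
    ∑ k F ∙ ∑ n (λ i → ∑ k (λ d → F (k + (i * k + d))))
      ≈⟨ ∙-cong refl (∑-blocks n k (λ j → F (k + j))) ⟩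
    ∑ k F ∙ ∑ (n * k) (λ j → F (k + j))
      ≈⟨ sym (∑-+ k (n * k) F) ⟩
    ∑ (k + n * k) F ∎

  ∑-periodic : ∀ l m H .{{_ : NonZero m}} → ∑ (l * m) (λ j → H (j % m)) ≈ ∑ l (λ _ → ∑ m H)
  ∑-periodic l m H = begin
    ∑ (l * m) (λ j → H (j % m))                       ≈⟨ sym (∑-blocks l m _) ⟩
    ∑ l (λ i → ∑ m (λ d → H ((i * m + d) % m)))       ≈⟨ ∑-cong l (λ i _ → ∑-cong m (λ d d<m →
                                                           reflexive (≡.cong H (residue i d d<m)))) ⟩
    ∑ l (λ _ → ∑ m H)                                 ∎
    where
    residue : ∀ i d → d < m → (i * m + d) % m ≡ d
    residue i d d<m = ≡.trans (≡.cong (_% m) (+-comm (i * m) d))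
                        (≡.trans ([m+kn]%n≡m%n d i m) (m<n⇒m%n≡m d<m))

module ∑ℕ = IndexedSum +-0-commutativeMonoid

∑ℕ-const : ∀ l y → ∑ℕ.∑ l (λ _ → y) ≡ l * y
∑ℕ-const zero    y = ≡.refl
∑ℕ-const (suc l) y = ≡.cong (y +_) (∑ℕ-const l y)

sumℕ-toℕ : ∀ {m} (F : ℕ → ℕ) → sumℕ {m} (λ j → F (toℕ j)) ≡ ∑ℕ.∑ m F
sumℕ-toℕ {zero}  F = ≡.refl
sumℕ-toℕ {suc m} F = ≡.cong (F 0 +_) (sumℕ-toℕ {m} (λ j → F (suc j)))

sumG-toℕ : ∀ {c ℓ} (G : AbelianGroup c ℓ) {m} (F : ℕ → AbelianGroup.Carrier G) →
           sumG G {m} (λ j → F (toℕ j)) ≡ IndexedSum.∑ (AbelianGroup.commutativeMonoid G) m F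
sumG-toℕ G {zero}  F = ≡.refl
sumG-toℕ G {suc m} F = ≡.cong (AbelianGroup._∙_ G (F 0)) (sumG-toℕ G {m} (λ j → F (suc j)))

module Counting where
  import Data.Fin.Permutation as Perm
  import Algebra.Properties.CommutativeMonoid.Sum as MonoidSum
  open ≡ using (refl; sym; trans; cong; cong₂)
  open import Algebra.Properties.CommutativeSemigroup +-commutativeSemigroup using (interchange)
  open ≡.≡-Reasoning

  sumℕ-cong : ∀ {n} {F G : Fin n → ℕ} → (∀ a → F a ≡ G a) → sumℕ F ≡ sumℕ G
  sumℕ-cong {zero}  F≡G = refl
  sumℕ-cong {suc n} F≡G = cong₂ _+_ (F≡G zero) (sumℕ-cong (λ a → F≡G (suc a)))

  sumℕ-+ : ∀ {n} (F G : Fin n → ℕ) → sumℕ (λ a → F a + G a) ≡ sumℕ F + sumℕ G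
  sumℕ-+ {zero}  F G = refl
  sumℕ-+ {suc n} F G = trans (cong (F zero + G zero +_) (sumℕ-+ (λ a → F (suc a)) (λ a → G (suc a))))
                             (interchange (F zero) (G zero) _ _)

  sumℕ-const : ∀ n x → sumℕ {n} (λ _ → x) ≡ n * x
  sumℕ-const n x = trans (sumℕ-toℕ {n} (λ _ → x)) (∑ℕ-const n x)

  sumℕ-zero : ∀ {n} (F : Fin n → ℕ) → (∀ a → F a ≡ 0) → sumℕ F ≡ 0
  sumℕ-zero {zero}  F F≡0 = refl
  sumℕ-zero {suc n} F F≡0 = cong₂ _+_ (F≡0 zero) (sumℕ-zero _ (λ a → F≡0 (suc a)))

  sumℕ-single : ∀ {n} (F : Fin n → ℕ) a₀ → (∀ a → a ≢ a₀ → F a ≡ 0) → sumℕ F ≡ F a₀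
  sumℕ-single {suc n} F zero     F≡0 =
    trans (cong (F zero +_) (sumℕ-zero _ (λ a → F≡0 (suc a) (λ ())))) (+-identityʳ _)
  sumℕ-single {suc n} F (suc a₀) F≡0 = trans (cong (_+ sumℕ (λ a → F (suc a))) (F≡0 zero (λ ())))
    (sumℕ-single (λ a → F (suc a)) a₀ (λ a a≢a₀ → F≡0 (suc a) (λ eq → a≢a₀ (Fin.suc-injective eq))))

  sumℕ-involution : ∀ {n} (F : Fin n → ℕ) (ι : Fin n → Fin n) → (∀ a → ι (ι a) ≡ a) →
                    sumℕ (λ a → F (ι a)) ≡ sumℕ F
  sumℕ-involution {n} F ι ι-involutive = begin
    sumℕ (λ a → F (ι a)) ≡⟨ sumℕ≡sum (λ a → F (ι a)) ⟩
    sum (λ a → F (ι a))  ≡⟨ sum-permute F (Perm.permutation ι ι ι-involutive ι-involutive) ⟨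
    sum F                ≡⟨ sumℕ≡sum F ⟨
    sumℕ F               ∎
    where
    open MonoidSum +-0-commutativeMonoid using (sum; sum-permute)
    sumℕ≡sum : ∀ {m} (G : Fin m → ℕ) → sumℕ G ≡ sum G
    sumℕ≡sum {zero}  G = refl
    sumℕ≡sum {suc m} G = cong (G zero +_) (sumℕ≡sum (λ a → G (suc a)))

  indicator : Bool → ℕ
  indicator b = if b then 1 else 0

  count : ∀ {b} → (Fin b → Bool) → ℕ
  count p = sumℕ (λ a → indicator (p a))

  count-not+count : ∀ {b} (p : Fin b → Bool) → count (λ a → not (p a)) + count p ≡ b
  count-not+count {b} p = begin
    count (λ a → not (p a)) + count p ≡⟨ sumℕ-+ (λ a → indicator (not (p a))) (λ a → indicator (p a)) ⟨
    sumℕ (λ a → indicator (not (p a)) + indicator (p a)) ≡⟨ sumℕ-cong (λ a → complement (p a)) ⟩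
    sumℕ {b} (λ _ → 1)                ≡⟨ sumℕ-const b 1 ⟩
    b * 1                             ≡⟨ *-identityʳ b ⟩
    b                                 ∎
    where
    complement : ∀ x → indicator (not x) + indicator x ≡ 1
    complement true  = refl
    complement false = refl

  module Pairing {b} (q : Fin b → Bool) (ι : Fin b → Fin b) (ι-involutive : ∀ a → ι (ι a) ≡ a)
                 (q∘ι≡q : ∀ a → q (ι a) ≡ q a) (ι-fixfree : ∀ a → q a ≡ true → ι a ≢ a) where

    isFirst : Fin b → Bool
    isFirst a = q a ∧ isYes (a Fin.<? ι a)

    isFirst⇒q : ∀ {a} → isFirst a ≡ true → q a ≡ true
    isFirst⇒q {a} first with q a
    ... | true = refl

    isFirst-both : ∀ a → isFirst a ≡ true → isFirst (ι a) ≡ true → ⊥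
    isFirst-both a first first′ with q a | q (ι a) | a Fin.<? ι a | ι a Fin.<? ι (ι a)
    ... | true | true | yes a<ιa | yes ιa<a = <-asym a<ιa (≡.subst (λ x → toℕ (ι a) < toℕ x) (ι-involutive a) ιa<a)

    indicator-isFirst-pair : ∀ a → indicator (isFirst a) + indicator (isFirst (ι a)) ≡ indicator (q a)
    indicator-isFirst-pair a rewrite ι-involutive a | q∘ι≡q a with q a in qa
    ... | false = refl
    ... | true with a Fin.<? ι a | ι a Fin.<? a
    ...   | yes a<ιa | yes ιa<a = ⊥-elim (<-asym a<ιa ιa<a)
    ...   | yes _    | no _     = refl
    ...   | no _     | yes _    = refl
    ...   | no a≮ιa  | no ιa≮a  = ⊥-elim (ι-fixfree a qa (Fin.toℕ-injective (≤-antisym (≮⇒≥ a≮ιa) (≮⇒≥ ιa≮a))))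

    count-isFirst : 2 * count isFirst ≡ count q
    count-isFirst = begin
      2 * sumℕ F                           ≡⟨ cong (sumℕ F +_) (+-identityʳ (sumℕ F)) ⟩
      sumℕ F + sumℕ F                      ≡⟨ cong (sumℕ F +_) (sumℕ-involution F ι ι-involutive) ⟨
      sumℕ F + sumℕ (λ a → F (ι a))        ≡⟨ sumℕ-+ F (λ a → F (ι a)) ⟨
      sumℕ (λ a → F a + F (ι a))           ≡⟨ sumℕ-cong indicator-isFirst-pair ⟩
      count q                              ∎
      where
      F : Fin b → ℕ
      F a = indicator (isFirst a)

  fixfree-involution⇒even : ∀ {b} (ι : Fin b → Fin b) → (∀ a → ι (ι a) ≡ a) → (∀ a → ι a ≢ a) → b % 2 ≡ 0
  fixfree-involution⇒even {b} ι ι-involutive ι-fixfree = begin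
    b % 2                           ≡⟨ cong (_% 2) (trans (sym (*-identityʳ b)) (sym (sumℕ-const b 1))) ⟩
    count {b} (λ _ → true) % 2      ≡⟨ cong (_% 2) count-isFirst ⟨
    (2 * count isFirst) % 2         ≡⟨ cong (_% 2) (*-comm 2 (count isFirst)) ⟩
    (count isFirst * 2) % 2         ≡⟨ m*n%n≡0 (count isFirst) 2 ⟩
    0                               ∎
    where open Pairing (λ _ → true) ι ι-involutive (λ _ → refl) (λ a _ → ι-fixfree a)

  enumerate : ∀ {b} (p : Fin b → Bool) → Fin (count p) → Fin b
  enumerate {suc b} p = extend (p zero) (enumerate (λ a → p (suc a)))
    where
    extend : ∀ x {c} → (Fin c → Fin b) → Fin (indicator x + c) → Fin (suc b)
    extend true  e zero    = zero
    extend true  e (suc r) = suc (e r)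
    extend false e r       = suc (e r)

  enumerate-sound : ∀ {b} (p : Fin b → Bool) r → p (enumerate p r) ≡ true
  enumerate-sound {suc b} p r with p zero in p0
  enumerate-sound {suc b} p zero    | true  = p0
  enumerate-sound {suc b} p (suc r) | true  = enumerate-sound (λ a → p (suc a)) r
  enumerate-sound {suc b} p r       | false = enumerate-sound (λ a → p (suc a)) r

  enumerate-injective : ∀ {b} (p : Fin b → Bool) r s → enumerate p r ≡ enumerate p s → r ≡ s
  enumerate-injective {suc b} p r s eq with p zero
  enumerate-injective {suc b} p zero    zero    eq | true  = refl
  enumerate-injective {suc b} p (suc r) (suc s) eq | true  =
    cong suc (enumerate-injective (λ a → p (suc a)) r s (Fin.suc-injective eq))
  enumerate-injective {suc b} p r       s       eq | false =
    enumerate-injective (λ a → p (suc a)) r s (Fin.suc-injective eq)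

  enumerate-complete : ∀ {b} (p : Fin b → Bool) a → p a ≡ true → ∃ λ r → enumerate p r ≡ a
  enumerate-complete {suc b} p a pa with p zero in p0
  enumerate-complete {suc b} p zero    pa | true = zero , refl
  enumerate-complete {suc b} p (suc a) pa | true
    with r , eq ← enumerate-complete (λ a → p (suc a)) a pa = suc r , cong suc eq
  enumerate-complete {suc b} p zero    pa | false with () ← trans (sym pa) p0
  enumerate-complete {suc b} p (suc a) pa | false
    with r , eq ← enumerate-complete (λ a → p (suc a)) a pa = r , cong suc eq

  sumℕ-enumerate : ∀ {b} (p : Fin b → Bool) (F : Fin b → ℕ) →
                   sumℕ (λ r → F (enumerate p r)) ≡ sumℕ (λ a → if p a then F a else 0)
  sumℕ-enumerate {zero}  p F = refl
  sumℕ-enumerate {suc b} p F with p zero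
  ... | true  = cong (F zero +_) (sumℕ-enumerate (λ a → p (suc a)) (λ a → F (suc a)))
  ... | false = sumℕ-enumerate (λ a → p (suc a)) (λ a → F (suc a))

  count-bijection : ∀ {b t} (p : Fin b → Bool) (e : Fin t → Fin b) → (∀ i j → e i ≡ e j → i ≡ j) →
                    (∀ i → p (e i) ≡ true) → (∀ a → p a ≡ true → ∃ λ i → e i ≡ a) → count p ≡ t
  count-bijection p e e-injective e-sound e-complete =
    ≤-antisym (Fin.injective⇒≤ {f = to} to-injective) (Fin.injective⇒≤ {f = from} from-injective)
    where
    to : Fin (count p) → Fin _
    to r = proj₁ (e-complete (enumerate p r) (enumerate-sound p r))
    to-injective : ∀ {r s} → to r ≡ to s → r ≡ s
    to-injective {r} {s} eq = enumerate-injective p r s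
      (trans (sym (proj₂ (e-complete (enumerate p r) (enumerate-sound p r))))
      (trans (cong e eq) (proj₂ (e-complete (enumerate p s) (enumerate-sound p s)))))
    from : Fin _ → Fin (count p)
    from i = proj₁ (enumerate-complete p (e i) (e-sound i))
    from-injective : ∀ {i j} → from i ≡ from j → i ≡ j
    from-injective {i} {j} eq = e-injective i j
      (trans (sym (proj₂ (enumerate-complete p (e i) (e-sound i))))
      (trans (cong (enumerate p) eq) (proj₂ (enumerate-complete p (e j) (e-sound j)))))

module FiniteGroup {c ℓ : Level} (G : AbelianGroup c ℓ) {v : ℕ} (ord : GroupOrder G v) where
  open AbelianGroup G
  open import Algebra.Properties.Group group
  open import Relation.Binary.Reasoning.Setoid setoid
  open import Data.Unit.Polymorphic using (tt)
  open Counting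

  element : Fin v → Carrier
  element = proj₁ ord

  element-injective : ∀ a b → element a ≈ element b → a ≡ b
  element-injective = proj₁ (proj₂ (proj₂ ord))

  index : Carrier → Fin v
  index x = proj₁ (proj₂ (proj₂ (proj₂ ord)) x tt)

  element-index : ∀ x → element (index x) ≈ x
  element-index x = proj₂ (proj₂ (proj₂ (proj₂ ord)) x tt)

  index-element : ∀ a → index (element a) ≡ a
  index-element a = element-injective _ _ (element-index (element a))

  index-cong : ∀ {x y} → x ≈ y → index x ≡ index y
  index-cong {x} {y} x≈y = element-injective _ _ (trans (element-index x) (trans x≈y (sym (element-index y))))

  -- Translation by x ≉ ε is a fixed-point-free involution when x ∙ x ≈ ε, which would make v even.
  x∙x≈ε⇒x≈ε : v % 2 ≡ 1 → ∀ x → x ∙ x ≈ ε → x ≈ ε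
  x∙x≈ε⇒x≈ε v-odd x x∙x≈ε with decEq G ord x ε
  ... | yes x≈ε = x≈ε
  ... | no x≉ε  = ⊥-elim (0≢1+n (≡.trans (≡.sym v%2≡0) v-odd))
    where
    translate : Fin v → Fin v
    translate a = index (element a ∙ x)
    translate-involutive : ∀ a → translate (translate a) ≡ a
    translate-involutive a = element-injective _ _ (begin
      element (translate (translate a)) ≈⟨ element-index _ ⟩
      element (translate a) ∙ x         ≈⟨ ∙-cong (element-index _) refl ⟩
      (element a ∙ x) ∙ x               ≈⟨ assoc _ _ _ ⟩
      element a ∙ (x ∙ x)               ≈⟨ ∙-cong refl x∙x≈ε ⟩
      element a ∙ ε                     ≈⟨ identityʳ _ ⟩
      element a                         ∎)
    translate-fixfree : ∀ a → translate a ≢ a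
    translate-fixfree a eq =
      x≉ε (identityʳ-unique (element a) x (trans (sym (element-index _)) (reflexive (≡.cong element eq))))
    v%2≡0 : v % 2 ≡ 0
    v%2≡0 = fixfree-involution⇒even translate translate-involutive translate-fixfree

  [≈?]-≈ : ∀ {x y} → x ≈ y → [_≈?_] G ord x y ≡ 1
  [≈?]-≈ {x} {y} x≈y with decEq G ord x y
  ... | yes _   = ≡.refl
  ... | no x≉y = ⊥-elim (x≉y x≈y)

  [≈?]-≉ : ∀ {x y} → ¬ x ≈ y → [_≈?_] G ord x y ≡ 0
  [≈?]-≉ {x} {y} x≉y with decEq G ord x y
  ... | yes x≈y = ⊥-elim (x≉y x≈y)
  ... | no _    = ≡.refl

  [≈?]-congˡ : ∀ {x x′} g → x ≈ x′ → [_≈?_] G ord x g ≡ [_≈?_] G ord x′ g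
  [≈?]-congˡ {x} {x′} g x≈x′ with decEq G ord x g | decEq G ord x′ g
  ... | yes _   | yes _    = ≡.refl
  ... | yes x≈g | no x′≉g = ⊥-elim (x′≉g (trans (sym x≈x′) x≈g))
  ... | no x≉g  | yes x′≈g = ⊥-elim (x≉g (trans x≈x′ x′≈g))
  ... | no _    | no _     = ≡.refl

  cellMult-± : ∀ g {w y} → w ≈ y ⊎ w ≈ y ⁻¹ → cellMult G ord g (just w) ≡ cellMult G ord g (just y)
  cellMult-± g (inj₁ w≈y) = ≡.cong₂ _+_ ([≈?]-congˡ g w≈y) ([≈?]-congˡ g (⁻¹-cong w≈y))
  cellMult-± g {y = y} (inj₂ w≈y⁻¹) =
    ≡.trans (≡.cong₂ _+_ ([≈?]-congˡ g w≈y⁻¹) ([≈?]-congˡ g (trans (⁻¹-cong w≈y⁻¹) (⁻¹-involutive y))))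
            (+-comm ([_≈?_] G ord (y ⁻¹) g) ([_≈?_] G ord y g))

module Representatives {c ℓ p : Level} (G : AbelianGroup c ℓ) {v : ℕ} (ord : GroupOrder G v) (v-odd : v % 2 ≡ 1)
                       (J : Pred (AbelianGroup.Carrier G) p) (J-subgroup : IsSubgroup G J)
                       {t : ℕ} (J-order : HasOrder G J t) where
  open AbelianGroup G
  open import Algebra.Properties.Group group
  open IsSubgroup J-subgroup
  open FiniteGroup G ord
  open Counting
  open ≡.≡-Reasoning

  J? : ∀ x → Dec (J x)
  J? x with Fin.any? (λ i → decEq G ord (proj₁ J-order i) x)
  ... | yes (i , i↦x) = yes (resp i↦x (proj₁ (proj₂ J-order) i))
  ... | no ∄i         = no (λ x∈J → ∄i (proj₂ (proj₂ (proj₂ J-order)) x x∈J))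

  outsideJ : Carrier → Bool
  outsideJ x = not (isYes (J? x))

  outsideJ-true⇒∉J : ∀ {x} → outsideJ x ≡ true → ¬ J x
  outsideJ-true⇒∉J {x} out with J? x
  ... | no x∉J = x∉J

  ∈J⇒outsideJ-false : ∀ {x} → J x → outsideJ x ≡ false
  ∈J⇒outsideJ-false {x} x∈J with J? x
  ... | yes _   = ≡.refl
  ... | no x∉J = ⊥-elim (x∉J x∈J)

  ∉J⇒outsideJ-true : ∀ {x} → ¬ J x → outsideJ x ≡ true
  ∉J⇒outsideJ-true {x} x∉J with J? x
  ... | yes x∈J = ⊥-elim (x∉J x∈J)
  ... | no _    = ≡.refl

  outsideJ-resp : ∀ {x y} → (J x → J y) → (J y → J x) → outsideJ x ≡ outsideJ y
  outsideJ-resp {x} {y} x⇒y y⇒x with J? x | J? y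
  ... | yes _   | yes _   = ≡.refl
  ... | yes x∈J | no y∉J  = ⊥-elim (y∉J (x⇒y x∈J))
  ... | no x∉J  | yes y∈J = ⊥-elim (x∉J (y⇒x y∈J))
  ... | no _    | no _    = ≡.refl

  outsideJ-cong : ∀ {x y} → x ≈ y → outsideJ x ≡ outsideJ y
  outsideJ-cong x≈y = outsideJ-resp (resp x≈y) (resp (sym x≈y))

  negate : Fin v → Fin v
  negate a = index (element a ⁻¹)

  element-negate : ∀ a → element (negate a) ≈ element a ⁻¹
  element-negate a = element-index _

  negate-involutive : ∀ a → negate (negate a) ≡ a
  negate-involutive a =
    element-injective _ _ (trans (element-index _) (trans (⁻¹-cong (element-negate a)) (⁻¹-involutive (element a))))

  outside : Fin v → Bool
  outside a = outsideJ (element a)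

  outside-negate : ∀ a → outside (negate a) ≡ outside a
  outside-negate a = ≡.trans (outsideJ-cong (element-negate a))
    (outsideJ-resp (λ a⁻¹∈J → resp (⁻¹-involutive (element a)) (closed-⁻¹ a⁻¹∈J)) closed-⁻¹)

  -- A fixed point a of negation has a ∙ a ≈ ε, so a ≈ ε ∈ J by oddness.
  negate-fixfree : ∀ a → outside a ≡ true → negate a ≢ a
  negate-fixfree a out eq = outsideJ-true⇒∉J out (resp (sym a≈ε) has-ε)
    where
    a≈ε : element a ≈ ε
    a≈ε = x∙x≈ε⇒x≈ε v-odd (element a)
      (trans (∙-cong refl (trans (reflexive (≡.cong element (≡.sym eq))) (element-negate a))) (inverseʳ (element a)))

  open Pairing outside negate negate-involutive outside-negate negate-fixfree
    using (isFirst; isFirst⇒q; isFirst-both; indicator-isFirst-pair; count-isFirst)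

  M : ℕ
  M = count isFirst

  R : Fin M → Carrier
  R r = element (enumerate isFirst r)

  count-J : count (λ a → isYes (J? (element a))) ≡ t
  count-J = count-bijection _ (λ i → index (e i)) index-e-injective index-e-sound index-e-complete
    where
    e : Fin t → Carrier
    e = proj₁ J-order
    index-e-injective : ∀ i j → index (e i) ≡ index (e j) → i ≡ j
    index-e-injective i j eq = proj₁ (proj₂ (proj₂ J-order)) i j
      (trans (sym (element-index (e i))) (trans (reflexive (≡.cong element eq)) (element-index (e j))))
    index-e-sound : ∀ i → isYes (J? (element (index (e i)))) ≡ true
    index-e-sound i with J? (element (index (e i)))
    ... | yes _   = ≡.refl
    ... | no e∉J = ⊥-elim (e∉J (resp (sym (element-index (e i))) (proj₁ (proj₂ J-order) i)))
    index-e-complete : ∀ a → isYes (J? (element a)) ≡ true → ∃ λ i → index (e i) ≡ a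
    index-e-complete a a∈J with J? (element a)
    ... | yes a∈J with i , i↦a ← proj₂ (proj₂ (proj₂ J-order)) (element a) a∈J =
      i , ≡.trans (index-cong i↦a) (index-element a)

  2M+t≡v : 2 * M + t ≡ v
  2M+t≡v = ≡.trans (≡.cong₂ _+_ count-isFirst (≡.sym count-J)) (count-not+count _)

  R-outside : ∀ r → outsideJ (R r) ≡ true
  R-outside r = isFirst⇒q (enumerate-sound isFirst r)

  R-∉J : ∀ r → ¬ J (R r)
  R-∉J r = outsideJ-true⇒∉J (R-outside r)

  R∙R≉ε : ∀ r s → ¬ R r ∙ R s ≈ ε
  R∙R≉ε r s Rr∙Rs≈ε = isFirst-both (enumerate isFirst r) (enumerate-sound isFirst r)
    (≡.subst (λ a → isFirst a ≡ true) (≡.sym negate-r≡s) (enumerate-sound isFirst s))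
    where
    negate-r≡s : negate (enumerate isFirst r) ≡ enumerate isFirst s
    negate-r≡s = element-injective _ _ (trans (element-negate _) (sym (inverseʳ-unique (R r) (R s) Rr∙Rs≈ε)))

  -- g is hit by R r exactly when index g is first in its ±-pair, and by (R r)⁻¹ when negate (index g) is.
  sumℕ-cellMult-R : ∀ g → sumℕ (λ r → cellMult G ord g (just (R r))) ≡ indicator (outsideJ g)
  sumℕ-cellMult-R g = begin
    sumℕ (λ r → cellMult G ord g (just (R r)))
      ≡⟨ sumℕ-+ (λ r → [_≈?_] G ord (R r) g) (λ r → [_≈?_] G ord (R r ⁻¹) g) ⟩
    sumℕ (λ r → [_≈?_] G ord (R r) g) + sumℕ (λ r → [_≈?_] G ord (R r ⁻¹) g)
      ≡⟨ ≡.cong₂ _+_ (hits (λ a → element a) (index g) (element-index g) (λ a a≈g → ≡.trans (≡.sym (index-element a)) (index-cong a≈g)))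
                     (hits (λ a → element a ⁻¹) (negate (index g)) (trans (⁻¹-cong (element-negate _))
                       (trans (⁻¹-involutive _) (element-index g))) negate-back) ⟩
    indicator (isFirst (index g)) + indicator (isFirst (negate (index g)))
      ≡⟨ indicator-isFirst-pair (index g) ⟩
    indicator (outside (index g))
      ≡⟨ ≡.cong indicator (outsideJ-cong (element-index g)) ⟩
    indicator (outsideJ g) ∎
    where
    negate-back : ∀ a → element a ⁻¹ ≈ g → a ≡ negate (index g)
    negate-back a a⁻¹≈g = element-injective _ _ (trans (sym (⁻¹-involutive (element a)))
      (trans (⁻¹-cong a⁻¹≈g) (sym (trans (element-negate _) (⁻¹-cong (element-index g))))))
    hits : (h : Fin v → Carrier) (a₀ : Fin v) → h a₀ ≈ g → (∀ a → h a ≈ g → a ≡ a₀) →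
           sumℕ (λ r → [_≈?_] G ord (h (enumerate isFirst r)) g) ≡ indicator (isFirst a₀)
    hits h a₀ ha₀≈g unique = ≡.trans (sumℕ-enumerate isFirst (λ a → [_≈?_] G ord (h a) g))
      (≡.trans (sumℕ-single _ a₀ off) (at-a₀ (isFirst a₀)))
      where
      off : ∀ a → a ≢ a₀ → (if isFirst a then [_≈?_] G ord (h a) g else 0) ≡ 0
      off a a≢a₀ with isFirst a
      ... | true  = [≈?]-≉ (λ ha≈g → a≢a₀ (unique a ha≈g))
      ... | false = ≡.refl
      at-a₀ : ∀ x → (if x then [_≈?_] G ord (h a₀) g else 0) ≡ indicator x
      at-a₀ true  = [≈?]-≈ ha₀≈g
      at-a₀ false = ≡.refl

module CyclicArray {c ℓ : Level} (G : AbelianGroup c ℓ) (n k : ℕ) .{{_ : NonZero n}} (k≤n : k ≤ n)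
                   (val : ℕ → ℕ → AbelianGroup.Carrier G) where
  open AbelianGroup G
  module ∑G = IndexedSum commutativeMonoid

  cell : ℕ → ℕ → Maybe Carrier
  cell i d with d <? k
  ... | yes _ = just (val i d)
  ... | no _  = nothing

  -- Row i holds val i 0, …, val i (k-1) in the cyclically consecutive columns starting at n - i.
  A : PFArray G n n
  A i j = cell (toℕ i) ((toℕ i + toℕ j) % n)

  columnStart : ℕ → ℕ
  columnStart j = (n ∸ j) % n

  columnStart<n : ∀ j → columnStart j < n
  columnStart<n j = m%n<n (n ∸ j) n

  columnStart-+ : ∀ {j d} → j < n → d < n → ((columnStart j + d) % n + j) % n ≡ d
  columnStart-+ {j} {d} j<n d<n = begin
    ((columnStart j + d) % n + j) % n ≡⟨ [m%n+o]%n≡[m+o]%n (columnStart j + d) j n ⟩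
    ((n ∸ j) % n + d + j) % n         ≡⟨ ≡.cong (_% n) (+-assoc ((n ∸ j) % n) d j) ⟩
    ((n ∸ j) % n + (d + j)) % n       ≡⟨ [m%n+o]%n≡[m+o]%n (n ∸ j) (d + j) n ⟩
    (n ∸ j + (d + j)) % n             ≡⟨ ≡.cong (_% n) n∸j+[d+j]≡d+n ⟩
    (d + n) % n                       ≡⟨ [m+n]%n≡m%n d n ⟩
    d % n                             ≡⟨ m<n⇒m%n≡m d<n ⟩
    d                                 ∎
    where
    open ≡.≡-Reasoning
    n∸j+[d+j]≡d+n : n ∸ j + (d + j) ≡ d + n
    n∸j+[d+j]≡d+n = begin
      n ∸ j + (d + j) ≡⟨ ≡.cong (n ∸ j +_) (+-comm d j) ⟩
      n ∸ j + (j + d) ≡⟨ +-assoc (n ∸ j) j d ⟨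
      n ∸ j + j + d   ≡⟨ ≡.cong (_+ d) (m∸n+n≡m (<⇒≤ j<n)) ⟩
      n + d           ≡⟨ +-comm n d ⟩
      d + n           ∎

  module _ {c′ ℓ′} (N : CommutativeMonoid c′ ℓ′) (h : Maybe Carrier → CommutativeMonoid.Carrier N)
           (h-nothing : CommutativeMonoid._≈_ N (h nothing) (CommutativeMonoid.ε N)) where
    private module N = CommutativeMonoid N
    open IndexedSum N

    ∑-cells : (W : ℕ → ℕ) → ∑ n (λ d → h (cell (W d) d)) N.≈ ∑ k (λ d → h (just (val (W d) d)))
    ∑-cells W = N.trans (∑-support _ k≤n empty) (∑-cong k filled-cell)
      where
      empty : ∀ d → k ≤ d → h (cell (W d) d) N.≈ N.ε
      empty d k≤d with d <? k
      ... | yes d<k = ⊥-elim (<⇒≱ d<k k≤d)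
      ... | no _    = h-nothing
      filled-cell : ∀ d → d < k → h (cell (W d) d) N.≈ h (just (val (W d) d))
      filled-cell d d<k with d <? k
      ... | yes _  = N.refl
      ... | no d≮k = ⊥-elim (d≮k d<k)

    ∑-row : ∀ i → ∑ n (λ j → h (cell i ((i + j) % n))) N.≈ ∑ k (λ d → h (just (val i d)))
    ∑-row i = N.trans (∑-rotate n i (λ d → h (cell i d))) (∑-cells (λ _ → i))

    ∑-column : ∀ {j} → j < n →
               ∑ n (λ i → h (cell i ((i + j) % n))) N.≈ ∑ k (λ d → h (just (val ((columnStart j + d) % n) d)))
    ∑-column {j} j<n = begin
      ∑ n (λ i → h (cell i ((i + j) % n)))
        ≈⟨ ∑-rotate n (columnStart j) (λ i → h (cell i ((i + j) % n))) ⟨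
      ∑ n (λ d → h (cell ((columnStart j + d) % n) (((columnStart j + d) % n + j) % n)))
        ≈⟨ ∑-cong n (λ d d<n → N.reflexive (≡.cong (λ e → h (cell ((columnStart j + d) % n) e)) (columnStart-+ j<n d<n))) ⟩
      ∑ n (λ d → h (cell ((columnStart j + d) % n) d))
        ≈⟨ ∑-cells (λ d → (columnStart j + d) % n) ⟩
      ∑ k (λ d → h (just (val ((columnStart j + d) % n) d))) ∎
      where open import Relation.Binary.Reasoning.Setoid N.setoid

  ∑-ones : ∑ℕ.∑ k (λ _ → 1) ≡ k
  ∑-ones = ≡.trans (∑ℕ-const k 1) (*-identityʳ k)

  rows-filled : ∀ i → sumℕ (λ j → filled G (A i j)) ≡ k
  rows-filled i = ≡.trans (sumℕ-toℕ {n} (λ j → filled G (cell (toℕ i) ((toℕ i + j) % n))))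
    (≡.trans (∑-row +-0-commutativeMonoid (filled G) ≡.refl (toℕ i)) ∑-ones)

  columns-filled : ∀ j → sumℕ (λ i → filled G (A i j)) ≡ k
  columns-filled j = ≡.trans (sumℕ-toℕ {n} (λ i → filled G (cell i ((i + toℕ j) % n))))
    (≡.trans (∑-column +-0-commutativeMonoid (filled G) ≡.refl (Fin.toℕ<n j)) ∑-ones)

  row-sum : ∀ i → sumG G (λ j → entry0 G (A i j)) ≈ ∑G.∑ k (val (toℕ i))
  row-sum i = trans (reflexive (sumG-toℕ G {n} (λ j → entry0 G (cell (toℕ i) ((toℕ i + j) % n)))))
    (∑-row commutativeMonoid (entry0 G) refl (toℕ i))

  column-sum : ∀ j → sumG G (λ i → entry0 G (A i j)) ≈ ∑G.∑ k (λ d → val ((columnStart (toℕ j) + d) % n) d)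
  column-sum j = trans (reflexive (sumG-toℕ G {n} (λ i → entry0 G (cell i ((i + toℕ j) % n)))))
    (∑-column commutativeMonoid (entry0 G) refl (Fin.toℕ<n j))

  mult-A : ∀ {v} (ord : GroupOrder G v) g →
           mult G ord A g ≡ ∑ℕ.∑ n (λ i → ∑ℕ.∑ k (λ d → cellMult G ord g (just (val i d))))
  mult-A ord g = ≡.trans (Counting.sumℕ-cong row) (sumℕ-toℕ {n} (λ i → ∑ℕ.∑ k (λ d → cm (just (val i d)))))
    where
    cm : Maybe Carrier → ℕ
    cm = cellMult G ord g
    row : ∀ i → sumℕ (λ j → cm (A i j)) ≡ ∑ℕ.∑ k (λ d → cm (just (val (toℕ i) d)))
    row i = ≡.trans (sumℕ-toℕ {n} (λ j → cm (cell (toℕ i) ((toℕ i + j) % n))))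
                    (∑-row +-0-commutativeMonoid cm ≡.refl (toℕ i))

module SignChoice {c ℓ : Level} (G : AbelianGroup c ℓ) (_≟_ : ∀ x y → Dec (AbelianGroup._≈_ G x y))
                  (x∙x≈ε⇒x≈ε : ∀ x → AbelianGroup._≈_ G (AbelianGroup._∙_ G x x) (AbelianGroup.ε G) →
                                     AbelianGroup._≈_ G x (AbelianGroup.ε G)) where
  open AbelianGroup G
  open import Algebra.Properties.Group group
  open import Algebra.Solver.CommutativeMonoid commutativeMonoid using (solve; _⊕_; _⊜_)
  open import Algebra.Properties.CommutativeSemigroup commutativeSemigroup using (x∙yz≈y∙xz)
  open import Relation.Binary.Reasoning.Setoid setoid

  signed : Bool → Carrier → Carrier
  signed true  y = y
  signed false y = y ⁻¹

  signed-± : ∀ σ y → signed σ y ≈ y ⊎ signed σ y ≈ y ⁻¹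
  signed-± true  y = inj₁ refl
  signed-± false y = inj₂ refl

  x≈x⁻¹⇒x≈ε : ∀ {x} → x ≈ x ⁻¹ → x ≈ ε
  x≈x⁻¹⇒x≈ε {x} x≈x⁻¹ = x∙x≈ε⇒x≈ε x (trans (∙-cong refl x≈x⁻¹) (inverseʳ x))

  signAvoiding : Carrier → Carrier → Bool
  signAvoiding s y with (y ∙ s) ≟ ε
  ... | yes _ = false
  ... | no _  = true

  -- y ∙ s ≈ ε and y ⁻¹ ∙ s ≈ ε together force y ≈ y ⁻¹.
  signAvoiding-≉ε : ∀ s y → ¬ y ≈ ε → ¬ signed (signAvoiding s y) y ∙ s ≈ ε
  signAvoiding-≉ε s y y≉ε with (y ∙ s) ≟ ε
  ... | no y∙s≉ε  = y∙s≉ε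
  ... | yes y∙s≈ε = λ y⁻¹∙s≈ε → y≉ε (x≈x⁻¹⇒x≈ε
        (trans (sym (trans (inverseʳ-unique (y ⁻¹) s y⁻¹∙s≈ε) (⁻¹-involutive y))) (inverseʳ-unique y s y∙s≈ε)))

  a∙w≈ε∧a⁻¹∙w≈ε⇒a≈ε : ∀ {a w} → a ∙ w ≈ ε → a ⁻¹ ∙ w ≈ ε → a ≈ ε
  a∙w≈ε∧a⁻¹∙w≈ε⇒a≈ε {a} {w} a∙w≈ε a⁻¹∙w≈ε =
    x≈x⁻¹⇒x≈ε (trans (inverseˡ-unique a w a∙w≈ε) (sym (inverseˡ-unique (a ⁻¹) w a⁻¹∙w≈ε)))

  opposite-sums≈ε⇒s≈ε : ∀ {a y s} → a ∙ (y ∙ s) ≈ ε → a ⁻¹ ∙ (y ⁻¹ ∙ s) ≈ ε → s ≈ ε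
  opposite-sums≈ε⇒s≈ε {a} {y} {s} e₁ e₂ = x∙x≈ε⇒x≈ε s (begin
    s ∙ s                                   ≈⟨ identityˡ _ ⟨
    ε ∙ (s ∙ s)                             ≈⟨ ∙-cong (inverseʳ a) (trans (∙-cong (inverseʳ y) refl) (identityˡ _)) ⟨
    (a ∙ a ⁻¹) ∙ ((y ∙ y ⁻¹) ∙ (s ∙ s))     ≈⟨ solve 5 (λ a b c d s → (a ⊕ c) ⊕ ((b ⊕ d) ⊕ (s ⊕ s)) ⊜ (a ⊕ (b ⊕ s)) ⊕ (c ⊕ (d ⊕ s)))
                                                 refl a y (a ⁻¹) (y ⁻¹) s ⟩
    (a ∙ (y ∙ s)) ∙ (a ⁻¹ ∙ (y ⁻¹ ∙ s))     ≈⟨ ∙-cong e₁ e₂ ⟩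
    ε ∙ ε                                   ≈⟨ identityˡ ε ⟩
    ε                                       ∎)

  signAvoidingBoth : Carrier → Carrier → Carrier → Bool
  signAvoidingBoth a y s with (a ∙ (y ∙ s)) ≟ ε | (a ∙ (y ⁻¹ ∙ s)) ≟ ε
  ... | no _ | no _ = true
  ... | _    | _    = false

  signAvoidingBoth-≉ε : ∀ a y s → ¬ a ≈ ε → ¬ s ≈ ε →
                        ∀ τ → ¬ signed (signAvoidingBoth a y s) a ∙ (signed τ y ∙ s) ≈ ε
  signAvoidingBoth-≉ε a y s a≉ε s≉ε τ with (a ∙ (y ∙ s)) ≟ ε | (a ∙ (y ⁻¹ ∙ s)) ≟ ε | τ
  ... | no e₊ | no e₋ | true  = e₊
  ... | no e₊ | no e₋ | false = e₋
  ... | yes e₊ | _    | true  = λ e → a≉ε (a∙w≈ε∧a⁻¹∙w≈ε⇒a≈ε e₊ e)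
  ... | yes e₊ | _    | false = λ e → s≉ε (opposite-sums≈ε⇒s≈ε e₊ e)
  ... | no _  | yes e₋ | false = λ e → a≉ε (a∙w≈ε∧a⁻¹∙w≈ε⇒a≈ε e₋ e)
  ... | no _  | yes e₋ | true  = λ e → s≉ε (opposite-sums≈ε⇒s≈ε e₋
                                    (trans (∙-cong refl (∙-cong (⁻¹-involutive y) refl)) e))

  module ∑G = IndexedSum commutativeMonoid

  record SignedFilling (n k : ℕ) .{{_ : NonZero n}} (x : ℕ → ℕ → Carrier) : Set (c ⊔ ℓ) where
    field
      val       : ℕ → ℕ → Carrier
      val-±     : ∀ i d → val i d ≈ x i d ⊎ val i d ≈ x i d ⁻¹
      row-≉ε    : ∀ i → ¬ ∑G.∑ k (val i) ≈ ε
      column-≉ε : ∀ r → r < n → ¬ ∑G.∑ k (λ d → val ((r + d) % n) d) ≈ ε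

  -- Column r meets row r at position 0 and row r + 1 (mod n) at position 1. The sign at position 0 of row i
  -- makes row i nonzero and the sign at position 1 of row r + 1 makes column r nonzero; they are chosen in the
  -- order row 0, column 0, row 1, …, column n - 1. The cycle closes at row 0, which is therefore made nonzero
  -- for both signs of its position-1 entry.
  module ThreeOrMore (n k′ : ℕ) .{{_ : NonZero n}} (x : ℕ → ℕ → Carrier) (x≉ε : ∀ i d → ¬ x i d ≈ ε) where
    k : ℕ
    k = 3 + k′

    -- The one sign chosen beyond position 1: flipping x 0 2 makes rowRest 0 nonzero.
    high : ℕ → ℕ → Carrier
    high zero zero = signed (signAvoiding (∑G.∑ k′ (λ d → x 0 (3 + d))) (x 0 2)) (x 0 2)
    high i    d    = x i (2 + d)

    high-± : ∀ i d → high i d ≈ x i (2 + d) ⊎ high i d ≈ x i (2 + d) ⁻¹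
    high-± zero    zero    = signed-± (signAvoiding (∑G.∑ k′ (λ d → x 0 (3 + d))) (x 0 2)) (x 0 2)
    high-± zero    (suc d) = inj₁ refl
    high-± (suc i) d       = inj₁ refl

    rowRest : ℕ → Carrier
    rowRest i = ∑G.∑ (suc k′) (high i)

    rowRest0-≉ε : ¬ rowRest 0 ≈ ε
    rowRest0-≉ε = signAvoiding-≉ε (∑G.∑ k′ (λ d → x 0 (3 + d))) (x 0 2) (x≉ε 0 2)

    columnRest : ℕ → Carrier
    columnRest r = ∑G.∑ (suc k′) (λ d → high ((r + (2 + d)) % n) d)

    columnSignAfter : ℕ → Bool → Bool
    columnSignAfter r σ = signAvoiding (signed σ (x r 0) ∙ columnRest r) (x ((r + 1) % n) 1)

    rowSign : ℕ → Bool
    rowSign zero    = signAvoidingBoth (x 0 0) (x 0 1) (rowRest 0)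
    rowSign (suc i) = signAvoiding (signed (columnSignAfter i (rowSign i)) (x (suc i) 1) ∙ rowRest (suc i)) (x (suc i) 0)

    columnSign : ℕ → Bool
    columnSign zero    = columnSignAfter (n ∸ 1) (rowSign (n ∸ 1))
    columnSign (suc i) = columnSignAfter i (rowSign i)

    columnSign-next : ∀ {r} → r < n → columnSign ((r + 1) % n) ≡ columnSignAfter r (rowSign r)
    columnSign-next {r} r<n with m≤n⇒m<n∨m≡n r<n
    ... | inj₁ 1+r<n = ≡.cong columnSign (≡.trans (≡.cong (_% n) (+-comm r 1)) (m<n⇒m%n≡m 1+r<n))
    ... | inj₂ 1+r≡n = ≡.trans (≡.cong columnSign r+1%n≡0) (≡.cong (λ m → columnSignAfter m (rowSign m)) n∸1≡r)
      where
      r+1%n≡0 : (r + 1) % n ≡ 0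
      r+1%n≡0 = ≡.trans (≡.cong (_% n) (≡.trans (+-comm r 1) 1+r≡n)) (n%n≡0 n)
      n∸1≡r : n ∸ 1 ≡ r
      n∸1≡r = ≡.cong (_∸ 1) (≡.sym 1+r≡n)

    val : ℕ → ℕ → Carrier
    val i zero          = signed (rowSign i) (x i 0)
    val i (suc zero)    = signed (columnSign i) (x i 1)
    val i (suc (suc d)) = high i d

    val-± : ∀ i d → val i d ≈ x i d ⊎ val i d ≈ x i d ⁻¹
    val-± i zero          = signed-± (rowSign i) (x i 0)
    val-± i (suc zero)    = signed-± (columnSign i) (x i 1)
    val-± i (suc (suc d)) = high-± i d

    row-≉ε : ∀ i → ¬ ∑G.∑ k (val i) ≈ ε
    row-≉ε zero    = signAvoidingBoth-≉ε (x 0 0) (x 0 1) (rowRest 0) (x≉ε 0 0) rowRest0-≉ε (columnSign 0)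
    row-≉ε (suc i) = signAvoiding-≉ε (val (suc i) 1 ∙ rowRest (suc i)) (x (suc i) 0) (x≉ε (suc i) 0)

    column-≉ε : ∀ r → r < n → ¬ ∑G.∑ k (λ d → val ((r + d) % n) d) ≈ ε
    column-≉ε r r<n column≈ε = signAvoiding-≉ε (val r 0 ∙ columnRest r) (x ((r + 1) % n) 1) (x≉ε _ 1) (begin
      signed (columnSignAfter r (rowSign r)) (x ((r + 1) % n) 1) ∙ (val r 0 ∙ columnRest r)
        ≡⟨ ≡.cong (λ σ → signed σ (x ((r + 1) % n) 1) ∙ (val r 0 ∙ columnRest r)) (columnSign-next r<n) ⟨
      val ((r + 1) % n) 1 ∙ (val r 0 ∙ columnRest r)
        ≈⟨ x∙yz≈y∙xz _ _ _ ⟩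
      val r 0 ∙ (val ((r + 1) % n) 1 ∙ columnRest r)
        ≡⟨ ≡.cong (λ i → val i 0 ∙ (val ((r + 1) % n) 1 ∙ columnRest r)) (≡.trans (≡.cong (_% n) (+-identityʳ r)) (m<n⇒m%n≡m r<n)) ⟨
      val ((r + 0) % n) 0 ∙ (val ((r + 1) % n) 1 ∙ columnRest r)
        ≈⟨ column≈ε ⟩
      ε ∎)

    signedFilling : SignedFilling n k x
    signedFilling = record { val = val ; val-± = val-± ; row-≉ε = row-≉ε ; column-≉ε = column-≉ε }

module Construction {c ℓ p : Level} (G : AbelianGroup c ℓ) {v : ℕ} (ord : GroupOrder G v) (v-odd : v % 2 ≡ 1)
                    (J : Pred (AbelianGroup.Carrier G) p) (J-subgroup : IsSubgroup G J)
                    {t : ℕ} (J-order : HasOrder G J t) where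
  open AbelianGroup G
  open FiniteGroup G ord
  open Representatives G ord v-odd J J-subgroup J-order
  open SignChoice G (decEq G ord) (x∙x≈ε⇒x≈ε v-odd)
  open Counting using (indicator; sumℕ-cong)
  open ≡.≡-Reasoning

  module _ {{_ : NonZero M}} where
    Rmod : ℕ → Carrier
    Rmod N = R (fromℕ< (m%n<n N M))

    Rmod-% : ∀ N → Rmod (N % M) ≡ Rmod N
    Rmod-% N = ≡.cong R (Fin.fromℕ<-cong _ _ (m%n%n≡m%n N M) _ _)

    Rmod-toℕ : ∀ r → Rmod (toℕ r) ≡ R r
    Rmod-toℕ r = ≡.cong R (≡.trans (Fin.fromℕ<-cong _ _ (m<n⇒m%n≡m (Fin.toℕ<n r)) _ _) (Fin.fromℕ<-toℕ r (Fin.toℕ<n r)))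

    -- Reading the array row by row runs λ′ times through R.
    ∑-cellMult-Rmod : ∀ λ′ n k → n * k ≡ λ′ * M → ∀ g →
                      ∑ℕ.∑ n (λ i → ∑ℕ.∑ k (λ d → cellMult G ord g (just (Rmod (i * k + d))))) ≡ λ′ * indicator (outsideJ g)
    ∑-cellMult-Rmod λ′ n k nk≡λ′M g = begin
      ∑ℕ.∑ n (λ i → ∑ℕ.∑ k (λ d → H (i * k + d))) ≡⟨ ∑ℕ.∑-blocks n k H ⟩
      ∑ℕ.∑ (n * k) H                              ≡⟨ ≡.cong (λ m → ∑ℕ.∑ m H) nk≡λ′M ⟩
      ∑ℕ.∑ (λ′ * M) H                             ≡⟨ ∑ℕ.∑-cong (λ′ * M) (λ N _ → ≡.cong (cm ∘ just) (Rmod-% N)) ⟨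
      ∑ℕ.∑ (λ′ * M) (λ N → H (N % M))             ≡⟨ ∑ℕ.∑-periodic λ′ M H ⟩
      ∑ℕ.∑ λ′ (λ _ → ∑ℕ.∑ M H)                    ≡⟨ ∑ℕ-const λ′ (∑ℕ.∑ M H) ⟩
      λ′ * ∑ℕ.∑ M H                               ≡⟨ ≡.cong (λ′ *_) (sumℕ-toℕ {M} H) ⟨
      λ′ * sumℕ {M} (λ r → H (toℕ r))             ≡⟨ ≡.cong (λ′ *_) (sumℕ-cong {M} (λ r → ≡.cong (cm ∘ just) (Rmod-toℕ r))) ⟩
      λ′ * sumℕ (λ r → cm (just (R r)))           ≡⟨ ≡.cong (λ′ *_) (sumℕ-cellMult-R g) ⟩
      λ′ * indicator (outsideJ g)                 ∎
      where
      cm : Maybe Carrier → ℕ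
      cm = cellMult G ord g
      H : ℕ → ℕ
      H N = cm (just (Rmod N))

    Rmod-≉ε : ∀ N → ¬ Rmod N ≈ ε
    Rmod-≉ε N Rmod≈ε = R-∉J _ (IsSubgroup.resp J-subgroup (sym Rmod≈ε) (IsSubgroup.has-ε J-subgroup))

    short-∑-≉ε : ∀ k .{{_ : NonZero k}} → k ≤ 2 → (W : ℕ → ℕ) → ¬ ∑G.∑ k (λ d → Rmod (W d)) ≈ ε
    short-∑-≉ε 1 _ W sum≈ε = Rmod-≉ε (W 0) (trans (sym (identityʳ _)) sum≈ε)
    short-∑-≉ε 2 _ W sum≈ε = R∙R≉ε _ _ (trans (∙-cong refl (sym (identityʳ _))) sum≈ε)
    short-∑-≉ε (suc (suc (suc _))) (s≤s (s≤s ()))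

    unsignedFilling : ∀ n k .{{_ : NonZero n}} .{{_ : NonZero k}} → k ≤ 2 →
                      SignedFilling n k (λ i d → Rmod (i * k + d))
    unsignedFilling n k k≤2 = record
      { val       = λ i d → Rmod (i * k + d)
      ; val-±     = λ _ _ → inj₁ refl
      ; row-≉ε    = λ i → short-∑-≉ε k k≤2 (λ d → i * k + d)
      ; column-≉ε = λ r _ → short-∑-≉ε k k≤2 (λ d → (r + d) % n * k + d)
      }

    signedFilling-R : ∀ n k .{{_ : NonZero n}} .{{_ : NonZero k}} → SignedFilling n k (λ i d → Rmod (i * k + d))
    signedFilling-R n 1 = unsignedFilling n 1 (s≤s z≤n)
    signedFilling-R n 2 = unsignedFilling n 2 (s≤s (s≤s z≤n))
    signedFilling-R n (suc (suc (suc k′))) = ThreeOrMore.signedFilling n k′ _ (λ i d → Rmod-≉ε _)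

    mult-filling : ∀ λ′ n k .{{_ : NonZero n}} (k≤n : k ≤ n) → n * k ≡ λ′ * M →
             (F : SignedFilling n k (λ i d → Rmod (i * k + d))) → ∀ g →
             mult G ord (CyclicArray.A G n k k≤n (SignedFilling.val F)) g ≡ λ′ * indicator (outsideJ g)
    mult-filling λ′ n k k≤n nk≡λ′M F g = begin
      mult G ord (CyclicArray.A G n k k≤n val) g                  ≡⟨ CyclicArray.mult-A G n k k≤n val ord g ⟩
      ∑ℕ.∑ n (λ i → ∑ℕ.∑ k (λ d → cm (just (val i d))))           ≡⟨ ∑ℕ.∑-cong n (λ i _ → ∑ℕ.∑-cong k (λ d _ → cellMult-± g (val-± i d))) ⟩
      ∑ℕ.∑ n (λ i → ∑ℕ.∑ k (λ d → cm (just (Rmod (i * k + d))))) ≡⟨ ∑-cellMult-Rmod λ′ n k nk≡λ′M g ⟩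
      λ′ * indicator (outsideJ g)                                  ∎
      where
      open SignedFilling F
      cm : Maybe Carrier → ℕ
      cm = cellMult G ord g

    filling-isNH : ∀ λ′ n k .{{_ : NonZero n}} (k≤n : k ≤ n) → n * k ≡ λ′ * M →
           (F : SignedFilling n k (λ i d → Rmod (i * k + d))) →
           IsNH G ord J λ′ n n k k (CyclicArray.A G n k k≤n (SignedFilling.val F))
    filling-isNH λ′ n k k≤n nk≡λ′M F =
      rows-filled , columns-filled , (λ g → mult-J g , mult-∉J g) ,
      (λ i row≈ε → row-≉ε (toℕ i) (trans (sym (row-sum i)) row≈ε)) ,
      (λ j column≈ε → column-≉ε (columnStart (toℕ j)) (columnStart<n (toℕ j)) (trans (sym (column-sum j)) column≈ε))
      where
      open SignedFilling F
      open CyclicArray G n k k≤n val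
      mult-J : ∀ g → J g → mult G ord A g ≡ 0
      mult-J g g∈J = ≡.trans (mult-filling λ′ n k k≤n nk≡λ′M F g) (≡.trans (≡.cong (λ b → λ′ * indicator b) (∈J⇒outsideJ-false g∈J)) (*-zeroʳ λ′))
      mult-∉J : ∀ g → ¬ J g → mult G ord A g ≡ λ′
      mult-∉J g g∉J = ≡.trans (mult-filling λ′ n k k≤n nk≡λ′M F g) (≡.trans (≡.cong (λ b → λ′ * indicator b) (∉J⇒outsideJ-true g∉J)) (*-identityʳ λ′))

    nh-exists : ∀ λ′ n k .{{_ : NonZero n}} .{{_ : NonZero k}} → k ≤ n → n * k ≡ λ′ * M →
                Σ (PFArray G n n) (IsNH G ord J λ′ n n k k)
    nh-exists λ′ n k k≤n nk≡λ′M = CyclicArray.A G n k k≤n (SignedFilling.val F) , filling-isNH λ′ n k k≤n nk≡λ′M F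
      where
      F : SignedFilling n k (λ i d → Rmod (i * k + d))
      F = signedFilling-R n k

λ′M≡nk : ∀ λ′ M t v nk → 2 * M + t ≡ v → λ′ * v ≡ 2 * nk + λ′ * t → λ′ * M ≡ nk
λ′M≡nk λ′ M t v nk 2M+t≡v λ′v≡2nk+λ′t = *-cancelˡ-≡ (λ′ * M) nk 2 (+-cancelʳ-≡ (λ′ * t) (2 * (λ′ * M)) (2 * nk) (begin
  2 * (λ′ * M) + λ′ * t ≡⟨ distrib λ′ M t ⟩
  λ′ * (2 * M + t)      ≡⟨ ≡.cong (λ′ *_) 2M+t≡v ⟩
  λ′ * v                ≡⟨ λ′v≡2nk+λ′t ⟩
  2 * nk + λ′ * t       ∎))
  where
  open ≡.≡-Reasoning
  distrib : ∀ l m t → 2 * (l * m) + l * t ≡ l * (2 * m + t)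
  distrib = solve-∀

-- NonZero λ′ follows from the equation and t ∣ v is Lagrange's theorem.
theorem3p4 : {c ℓ p : Level} (G : AbelianGroup c ℓ) (v : ℕ) (ord : GroupOrder G v) →
    v % 2 ≡ 1 →
    (J : Pred (AbelianGroup.Carrier G) p) → IsSubgroup G J → (t : ℕ) → HasOrder G J t →
    (λ' n k : ℕ) → NonZero λ' → NonZero n → NonZero k → k ≤ n →
    λ' * v ≡ 2 * n * k + λ' * t → t ∣ v →
    Σ (PFArray G n n) λ A → IsNH G ord J λ' n n k k A
theorem3p4 G v ord v-odd J J-subgroup t J-order λ′ n k _ n≢0 k≢0 k≤n λ′v≡2nk+λ′t _ =
  nh-exists λ′ n k k≤n (≡.sym λ′M≡nk′)
  where
  instance
    n-nonZero : NonZero n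
    n-nonZero = n≢0
    k-nonZero : NonZero k
    k-nonZero = k≢0
  open Representatives G ord v-odd J J-subgroup J-order using (M; 2M+t≡v)
  λ′M≡nk′ : λ′ * M ≡ n * k
  λ′M≡nk′ = λ′M≡nk λ′ M t v (n * k) 2M+t≡v (≡.trans λ′v≡2nk+λ′t (≡.cong (_+ λ′ * t) (*-assoc 2 n k)))
  instance
    M≢0 : NonZero M
    M≢0 = m*n≢0⇒n≢0 λ′ {{≡.subst NonZero (≡.sym λ′M≡nk′) (m*n≢0 n k)}}
  open Construction G ord v-odd J J-subgroup J-order using (nh-exists)
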